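{- For every $k\in\mathbb{N}$ with $k\ge 2$ there exists a first-order formula $\pi(x,y,z)$ of vocabulary $\{A,M\}$ such that the following holds: Let $\mathfrak{N}$ be a partial model of arithmetic with $n=|\mathrm{Dom}(\mathfrak{N})|\ge k^2$, and suppose there is $a^*\in\mathrm{Dom}(\mathfrak{N})$ such that $n^{1/k}\le a^*\le n^{1-1/k}/k$ and $k\,a^*\,\gamma(M^{\mathfrak{N}},a^*)\ge n$. Then $\pi^{\mathfrak{N}}=\{(a,b,c)\in\{0,\dots,n-1\}^3: ab=c\}$.
   Context: A partial multiplication is a ternary relation $R\subseteq\mathbb{N}^3$ such that $(a,b,c)\in R$ implies $ab=c$. For a partial multiplication $R$ and $k\in\mathbb{N}$, $\gamma(R,k)$ is the largest $r\in\mathbb{N}$ such that $r=0$ or for all $a,b\in\mathbb{N}$ with $a\le k$ and $b\le r$ we have $(a,b,ab)\in R$. $A,M$ are ternary relation symbols. A partial model of arithmetic is a finite $\{A,M\}$-structure $\mathfrak{N}$ with $\mathrm{Dom}(\mathfrak{N})=\{0,1,\dots,n-1\}$, $A^{\mathfrak{N}}=\{(a,b,c)\in\mathrm{Dom}(\mathfrak{N})^3:a+b=c\}$, and $M^{\mathfrak{N}}$ a partial multiplication. $\pi^{\mathfrak{N}}$ denotes the set of triples satisfying $\pi$ in $\mathfrak{N}$. -}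

module Defs where

open import Data.Nat using (ℕ; zero; suc; _+_; _*_; _≤_; _<_)
open import Data.Fin using (Fin; toℕ)
open import Data.Bool using (Bool; T)
open import Data.Product using (Σ; _×_; ∃)
open import Data.Sum using (_⊎_)
open import Data.Empty using (⊥)
open import Data.Unit using (⊤)
open import Relation.Binary.PropositionalEquality using (_≡_)

-- A is interpreted as true addition (restricted to the domain); M is a
-- finite (hence decidable, given as a Bool-valued predicate) relation on
-- ℕ³ contained in Dom³ and satisfying (a,b,c) ∈ M ⇒ ab = c.
record PartialModel (n : ℕ) : Set where
  field
    M     : ℕ → ℕ → ℕ → Bool
    sound : ∀ a b c → T (M a b c) → a < n × b < n × c < n × a * b ≡ c

Good : (ℕ → ℕ → ℕ → Bool) → ℕ → ℕ → Set
Good R k r = r ≡ 0 ⊎ (∀ a b → a ≤ k → b ≤ r → T (R a b (a * b)))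

IsGamma : (ℕ → ℕ → ℕ → Bool) → ℕ → ℕ → Set
IsGamma R k r = Good R k r × (∀ r′ → Good R k r′ → r′ ≤ r)

data Formula (m : ℕ) : Set where
  eq   : Fin m → Fin m → Formula m
  A    : Fin m → Fin m → Fin m → Formula m
  M    : Fin m → Fin m → Fin m → Formula m
  ⊤f   : Formula m
  ⊥f   : Formula m
  ¬f   : Formula m → Formula m
  _∧f_ : Formula m → Formula m → Formula m
  _∨f_ : Formula m → Formula m → Formula m
  _⇒f_ : Formula m → Formula m → Formula m
  ∃f   : Formula (suc m) → Formula m
  ∀f   : Formula (suc m) → Formula m

extend : ∀ {m n} → (Fin m → Fin n) → Fin n → Fin (suc m) → Fin n
extend ρ d Fin.zero    = d
extend ρ d (Fin.suc i) = ρ i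

Sat : ∀ {n m} → PartialModel n → Formula m → (Fin m → Fin n) → Set
Sat 𝔑 (eq i j)   ρ = toℕ (ρ i) ≡ toℕ (ρ j)
Sat 𝔑 (A i j k)  ρ = toℕ (ρ i) + toℕ (ρ j) ≡ toℕ (ρ k)
Sat 𝔑 (M i j k)  ρ = T (PartialModel.M 𝔑 (toℕ (ρ i)) (toℕ (ρ j)) (toℕ (ρ k)))
Sat 𝔑 ⊤f         ρ = ⊤
Sat 𝔑 ⊥f         ρ = ⊥
Sat 𝔑 (¬f φ)     ρ = Sat 𝔑 φ ρ → ⊥
Sat 𝔑 (φ ∧f ψ)   ρ = Sat 𝔑 φ ρ × Sat 𝔑 ψ ρ
Sat 𝔑 (φ ∨f ψ)   ρ = Sat 𝔑 φ ρ ⊎ Sat 𝔑 ψ ρ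
Sat 𝔑 (φ ⇒f ψ)   ρ = Sat 𝔑 φ ρ → Sat 𝔑 ψ ρ
Sat {n} 𝔑 (∃f φ) ρ = Σ (Fin n) (λ d → Sat 𝔑 φ (extend ρ d))
Sat {n} 𝔑 (∀f φ) ρ = (d : Fin n) → Sat 𝔑 φ (extend ρ d)

triple : ∀ {n} → Fin n → Fin n → Fin n → Fin 3 → Fin n
triple a b c Fin.zero = a
triple a b c (Fin.suc Fin.zero) = b
triple a b c (Fin.suc (Fin.suc Fin.zero)) = c

{-# OPTIONS --safe #-}
-- The formula performs long multiplication in base b = min(a*, γ), all intermediate
-- results being quantified existentially. Since M ⊆ true multiplication and A is true
-- addition, every witness computes the true product, in any partial model. Conversely,
-- n ≤ a*ᵏ and, via (k a*)ᵏ ≤ nᵏ⁻¹ and n ≤ k a* γ, also n ≤ γᵏ, so every element has at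
-- most k digits; the a* × γ table contained in M holds all products of two digits and all
-- b · w with w ≤ max(a*, γ), and as n ≤ k · b · max(a*, γ) every product b · w in the
-- domain is a sum of k of those.
module Submission where

open import Defs
open import Data.Nat using (ℕ; zero; suc; _+_; _*_; _^_; _∸_; _⊓_; _≤_; _<_; _≤?_; NonZero; z≤n)
open import Data.Nat.Base using (>-nonZero; ≢-nonZero⁻¹)
open import Data.Nat.Properties
open import Data.Nat.DivMod using (_/_; _%_; m≡m%n+[m/n]*n; m%n<n; m%n≤m; m/n≤m; m<n*o⇒m/o<n)
open import Algebra.Properties.CommutativeSemigroup *-commutativeSemigroup using (interchange)
open import Data.Fin using (Fin; toℕ; fromℕ<; #_; _↑ʳ_)
open import Data.Fin.Properties using (toℕ-fromℕ<; toℕ<n)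
open import Data.Product using (Σ; _×_; _,_; proj₂)
open import Data.Sum using (_⊎_; inj₁; inj₂)
open import Data.Bool using (T)
open import Data.Empty using (⊥-elim)
open import Relation.Nullary using (yes; no)
open import Function.Bundles using (_⇔_; mk⇔)
open import Relation.Binary.PropositionalEquality
  using (_≡_; refl; sym; trans; cong; cong₂; subst; module ≡-Reasoning)

m+m≡m⇒m≡0 : ∀ m → m + m ≡ m → m ≡ 0
m+m≡m⇒m≡0 m e = +-cancelˡ-≡ m m 0 (trans e (sym (+-identityʳ m)))

^-distribʳ-* : ∀ m n o → (m * n) ^ o ≡ m ^ o * n ^ o
^-distribʳ-* m n zero    = refl
^-distribʳ-* m n (suc o) = begin
  m * n * (m * n) ^ o       ≡⟨ cong (m * n *_) (^-distribʳ-* m n o) ⟩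
  m * n * (m ^ o * n ^ o)   ≡⟨ interchange m n (m ^ o) (n ^ o) ⟩
  m * m ^ o * (n * n ^ o)   ∎
  where open ≡-Reasoning

n*[m/n]+m%n≡m : ∀ m n .{{_ : NonZero n}} → n * (m / n) + m % n ≡ m
n*[m/n]+m%n≡m m n = begin
  n * (m / n) + m % n  ≡⟨ cong (_+ m % n) (*-comm n (m / n)) ⟩
  m / n * n + m % n    ≡⟨ +-comm (m / n * n) (m % n) ⟩
  m % n + m / n * n    ≡⟨ m≡m%n+[m/n]*n m n ⟨
  m                    ∎
  where open ≡-Reasoning

long-multiplication-step : ∀ b q r x y → b * q + r ≡ x → b * (q * y) + r * y ≡ x * y
long-multiplication-step b q r x y e = begin
  b * (q * y) + r * y  ≡⟨ cong (_+ r * y) (*-assoc b q y) ⟨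
  b * q * y + r * y    ≡⟨ *-distribʳ-+ y (b * q) r ⟨
  (b * q + r) * y      ≡⟨ cong (_* y) e ⟩
  x * y                ∎
  where open ≡-Reasoning

root-bound : ∀ {n c g} m → 0 < n → n ≤ c * g → c ^ suc m ≤ n ^ m → n ≤ g ^ suc m
root-bound {n} {c} {g} m 0<n n≤cg cᵏ≤nᵐ =
  *-cancelʳ-≤ n (g ^ suc m) (n ^ m) {{m^n≢0 n m {{>-nonZero 0<n}}}} (begin
    n ^ suc m              ≤⟨ ^-monoˡ-≤ (suc m) n≤cg ⟩
    (c * g) ^ suc m        ≡⟨ ^-distribʳ-* c g (suc m) ⟩
    c ^ suc m * g ^ suc m  ≤⟨ *-monoˡ-≤ (g ^ suc m) cᵏ≤nᵐ ⟩
    n ^ m * g ^ suc m      ≡⟨ *-comm (n ^ m) (g ^ suc m) ⟩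
    g ^ suc m * n ^ m      ∎)
  where open ≤-Reasoning

resp₃ : (P : ℕ → ℕ → ℕ → Set) → ∀ {a b c x y z} → a ≡ x → b ≡ y → c ≡ z → P x y z → P a b c
resp₃ P refl refl refl p = p

Formula₄ : Set
Formula₄ = ∀ {m} → Fin m → Fin m → Fin m → Fin m → Formula m

IsZero : ∀ {m} → Fin m → Formula m
IsZero x = A x x x

TimesBy : ℕ → ∀ {m} → Fin m → Fin m → Fin m → Formula m
TimesBy zero    h w v = IsZero w ∧f IsZero v
TimesBy (suc t) h w v =
  ∃f (∃f (∃f (∃f (split (4 ↑ʳ h) (4 ↑ʳ w) (4 ↑ʳ v) (# 3) (# 2) (# 1) (# 0)))))
  where
  split : ∀ {m} (h w v w₁ v₁ w₂ v₂ : Fin m) → Formula m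
  split h w v w₁ v₁ w₂ v₂ =
    (M h w₁ v₁ ∨f M w₁ h v₁) ∧f (TimesBy t h w₂ v₂ ∧f (A w₁ w₂ w ∧f A v₁ v₂ v))

-- z = x · y for x with j digits in base h: x = h x′ + d and z = h (x′ y) + d y, where
-- low computes d · y for a digit d and TimesBy t computes multiplication by h.
LongMul : ℕ → Formula₄ → ℕ → Formula₄
LongMul t low zero    h x y z = IsZero x ∧f IsZero z
LongMul t low (suc j) h x y z =
  ∃f (∃f (∃f (∃f (∃f (∃f (step (6 ↑ʳ h) (6 ↑ʳ x) (6 ↑ʳ y) (6 ↑ʳ z)
                                (# 5) (# 4) (# 3) (# 2) (# 1) (# 0)))))))
  where
  step : ∀ {m} (h x y z x′ d hx′ x′y hx′y dy : Fin m) → Formula m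
  step h x y z x′ d hx′ x′y hx′y dy =
    TimesBy t h x′ hx′ ∧f (A hx′ d x ∧f (LongMul t low j h x′ y x′y ∧f
    (TimesBy t h x′y hx′y ∧f (low h d y dy ∧f A hx′y dy z))))

DigitProduct : Formula₄
DigitProduct h d y w = M d y w

-- A digit times y is computed as y times the digit, by long multiplication of y.
Product : ℕ → Formula₄
Product k = LongMul k (λ h d y w → LongMul k DigitProduct k h y d w) k

MulFormula : ℕ → Formula 3
MulFormula k = ∃f (Product k (# 0) (# 1) (# 2) (# 3))

module Soundness {n : ℕ} (𝔑 : PartialModel n) where
  open PartialModel 𝔑 using (sound) renaming (M to R)
  open ≡-Reasoning

  Sound : Formula₄ → Set
  Sound φ = ∀ {m} (ρ : Fin m → Fin n) h x y z →
    Sat 𝔑 (φ h x y z) ρ → toℕ (ρ z) ≡ toℕ (ρ x) * toℕ (ρ y)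

  R-sound : ∀ {a b c} → T (R a b c) → c ≡ a * b
  R-sound t = sym (proj₂ (proj₂ (proj₂ (sound _ _ _ t))))

  IsZero-sound : ∀ {m} (ρ : Fin m → Fin n) x → Sat 𝔑 (IsZero x) ρ → toℕ (ρ x) ≡ 0
  IsZero-sound ρ x = m+m≡m⇒m≡0 (toℕ (ρ x))

  TimesBy-sound : ∀ t {m} (ρ : Fin m → Fin n) h w v →
    Sat 𝔑 (TimesBy t h w v) ρ → toℕ (ρ v) ≡ toℕ (ρ h) * toℕ (ρ w)
  TimesBy-sound zero ρ h w v (w≡0 , v≡0) = begin
    toℕ (ρ v)             ≡⟨ IsZero-sound ρ v v≡0 ⟩
    0                     ≡⟨ *-zeroʳ (toℕ (ρ h)) ⟨
    toℕ (ρ h) * 0         ≡⟨ cong (toℕ (ρ h) *_) (IsZero-sound ρ w w≡0) ⟨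
    toℕ (ρ h) * toℕ (ρ w) ∎
  TimesBy-sound (suc t) ρ h w v (w₁ , v₁ , w₂ , v₂ , atom , rest , w₁+w₂ , v₁+v₂) = begin
    toℕ (ρ v)                    ≡⟨ v₁+v₂ ⟨
    toℕ v₁ + toℕ v₂              ≡⟨ cong₂ _+_ (atom-sound atom) (TimesBy-sound t _ _ _ _ rest) ⟩
    H * toℕ w₁ + H * toℕ w₂      ≡⟨ *-distribˡ-+ H (toℕ w₁) (toℕ w₂) ⟨
    H * (toℕ w₁ + toℕ w₂)        ≡⟨ cong (H *_) w₁+w₂ ⟩
    H * toℕ (ρ w)                ∎
    where
    H = toℕ (ρ h)
    atom-sound : ∀ {a b c} → T (R a b c) ⊎ T (R b a c) → c ≡ a * b
    atom-sound (inj₁ r) = R-sound r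
    atom-sound {a} {b} (inj₂ r) = trans (R-sound r) (*-comm b a)

  LongMul-sound : ∀ t {low : Formula₄} → Sound low → ∀ j → Sound (LongMul t low j)
  LongMul-sound t low-sound zero ρ h x y z (x≡0 , z≡0) = begin
    toℕ (ρ z)             ≡⟨ IsZero-sound ρ z z≡0 ⟩
    0                     ≡⟨ cong (_* toℕ (ρ y)) (IsZero-sound ρ x x≡0) ⟨
    toℕ (ρ x) * toℕ (ρ y) ∎
  LongMul-sound t low-sound (suc j) ρ h x y z
    (x′ , d , hx′ , x′y , hx′y , dy , s-hx′ , hx′+d , s-x′y , s-hx′y , s-dy , hx′y+dy) = begin
    toℕ (ρ z)                      ≡⟨ hx′y+dy ⟨
    toℕ hx′y + toℕ dy              ≡⟨ cong₂ _+_ hx′y≡ (low-sound _ _ _ _ _ s-dy) ⟩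
    H * (toℕ x′ * Y) + toℕ d * Y   ≡⟨ long-multiplication-step H (toℕ x′) (toℕ d) (toℕ (ρ x)) Y x≡ ⟩
    toℕ (ρ x) * Y                  ∎
    where
    H = toℕ (ρ h)
    Y = toℕ (ρ y)
    hx′y≡ : toℕ hx′y ≡ H * (toℕ x′ * Y)
    hx′y≡ = trans (TimesBy-sound t _ _ _ _ s-hx′y)
                  (cong (H *_) (LongMul-sound t low-sound j _ _ _ _ _ s-x′y))
    x≡ : H * toℕ x′ + toℕ d ≡ toℕ (ρ x)
    x≡ = trans (cong (_+ toℕ d) (sym (TimesBy-sound t _ _ _ _ s-hx′))) hx′+d

  Product-sound : ∀ k → Sound (Product k)
  Product-sound k = LongMul-sound k transposed k
    where
    transposed : Sound (λ h d y w → LongMul k DigitProduct k h y d w)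
    transposed ρ h d y w s =
      trans (LongMul-sound k (λ ρ h d y w → R-sound) k ρ h y d w s) (*-comm (toℕ (ρ y)) (toℕ (ρ d)))

  MulFormula-sound : ∀ k {a b c} → Sat 𝔑 (MulFormula k) (triple a b c) → toℕ a * toℕ b ≡ toℕ c
  MulFormula-sound k (h , s) = sym (Product-sound k _ (# 0) (# 1) (# 2) (# 3) s)

-- For the theorem, base and range are min(a*, γ) and max(a*, γ).
record MultiplicationBase {n : ℕ} (𝔑 : PartialModel n) (k : ℕ) : Set where
  field
    base range : ℕ
    base<n : base < n
    n≤base^k : n ≤ base ^ k
    n≤base*k*range : n ≤ base * (k * range)
    times-base : ∀ w → w ≤ range →
      T (PartialModel.M 𝔑 base w (base * w)) ⊎ T (PartialModel.M 𝔑 w base (w * base))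
    digit-product : ∀ d e → d < base → e < base → T (PartialModel.M 𝔑 d e (d * e))

module Completeness {n : ℕ} {𝔑 : PartialModel n} {k : ℕ} (𝔅 : MultiplicationBase 𝔑 k) where
  open PartialModel 𝔑 using () renaming (M to R)
  open MultiplicationBase 𝔅

  instance
    base≢0 : NonZero base
    base≢0 = m*n≢0⇒m≢0 base {{>-nonZero (<-≤-trans (≤-<-trans z≤n base<n) n≤base*k*range)}}

  Complete : (ℕ → Set) → (ℕ → Set) → Formula₄ → Set
  Complete P Q φ = ∀ {m} (ρ : Fin m → Fin n) h x y z {X Y} →
    toℕ (ρ h) ≡ base → toℕ (ρ x) ≡ X → toℕ (ρ y) ≡ Y → toℕ (ρ z) ≡ X * Y →
    P X → Q Y → Sat 𝔑 (φ h x y z) ρ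

  record Element (x : ℕ) : Set where
    field
      elem  : Fin n
      value : toℕ elem ≡ x
  open Element

  element-below : ∀ {x y} (i : Fin n) → toℕ i ≡ y → x ≤ y → Element x
  element-below i refl x≤y = record { elem = fromℕ< x<n ; value = toℕ-fromℕ< x<n }
    where x<n = ≤-<-trans x≤y (toℕ<n i)

  Sum Atom : ℕ → ℕ → ℕ → Set
  Sum a b c = a + b ≡ c
  Atom a b c = T (R a b c)

  IsZero-complete : ∀ {m} (ρ : Fin m → Fin n) x → toℕ (ρ x) ≡ 0 → Sat 𝔑 (IsZero x) ρ
  IsZero-complete ρ x x≡0 = subst (λ v → v + v ≡ v) (sym x≡0) refl

  TimesBy-complete : ∀ t {m} (ρ : Fin m → Fin n) h w v {W} →
    toℕ (ρ h) ≡ base → toℕ (ρ w) ≡ W → toℕ (ρ v) ≡ base * W → W ≤ t * range →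
    Sat 𝔑 (TimesBy t h w v) ρ
  TimesBy-complete zero ρ h w v ⟦h⟧ ⟦w⟧ ⟦v⟧ W≤0 =
    IsZero-complete ρ w (trans ⟦w⟧ W≡0) ,
    IsZero-complete ρ v (trans ⟦v⟧ (trans (cong (base *_) W≡0) (*-zeroʳ base)))
    where W≡0 = n≤0⇒n≡0 W≤0
  TimesBy-complete (suc t) ρ h w v {W} ⟦h⟧ ⟦w⟧ ⟦v⟧ W≤ =
    elem w₁ , elem v₁ , elem w₂ , elem v₂ , atom ,
    TimesBy-complete t _ (4 ↑ʳ h) (# 1) (# 0) ⟦h⟧ (value w₂) (value v₂) w₂≤ ,
    resp₃ Sum (value w₁) (value w₂) ⟦w⟧ w₁+w₂ ,
    resp₃ Sum (value v₁) (value v₂) ⟦v⟧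
      (trans (sym (*-distribˡ-+ base W₁ W₂)) (cong (base *_) w₁+w₂))
    where
    W₁ = range ⊓ W
    W₂ = W ∸ range
    w₁+w₂ : W₁ + W₂ ≡ W
    w₁+w₂ = m⊓n+n∸m≡n range W
    w₂≤ : W₂ ≤ t * range
    w₂≤ = ≤-trans (∸-monoˡ-≤ range W≤) (≤-reflexive (m+n∸m≡n range (t * range)))
    w₁ = element-below (ρ w) ⟦w⟧ (m⊓n≤n range W)
    w₂ = element-below (ρ w) ⟦w⟧ (m∸n≤m W range)
    v₁ = element-below (ρ v) ⟦v⟧ (*-monoʳ-≤ base (m⊓n≤n range W))
    v₂ = element-below (ρ v) ⟦v⟧ (*-monoʳ-≤ base (m∸n≤m W range))
    atom : Atom (toℕ (ρ h)) (toℕ (elem w₁)) (toℕ (elem v₁)) ⊎ Atom (toℕ (elem w₁)) (toℕ (ρ h)) (toℕ (elem v₁))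
    atom with times-base W₁ (m⊓n≤m range W)
    ... | inj₁ r = inj₁ (resp₃ Atom ⟦h⟧ (value w₁) (value v₁) r)
    ... | inj₂ r = inj₂ (resp₃ Atom (value w₁) ⟦h⟧ (trans (value v₁) (*-comm base W₁)) r)

  times-complete : ∀ {m} (ρ : Fin m → Fin n) h w v {W} →
    toℕ (ρ h) ≡ base → toℕ (ρ w) ≡ W → toℕ (ρ v) ≡ base * W → Sat 𝔑 (TimesBy k h w v) ρ
  times-complete ρ h w v {W} ⟦h⟧ ⟦w⟧ ⟦v⟧ = TimesBy-complete k ρ h w v ⟦h⟧ ⟦w⟧ ⟦v⟧
    (<⇒≤ (*-cancelˡ-< base W (k * range) (<-≤-trans bW<n n≤base*k*range)))
    where
    bW<n : base * W < n
    bW<n = subst (_< n) ⟦v⟧ (toℕ<n (ρ v))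

  LongMul-complete : ∀ {low : Formula₄} {Q} → Complete (_< base) Q low →
    ∀ j → Complete (_< base ^ j) Q (LongMul k low j)
  LongMul-complete low-complete zero ρ h x y z {X} {Y} ⟦h⟧ ⟦x⟧ ⟦y⟧ ⟦z⟧ X<1 _ =
    IsZero-complete ρ x (trans ⟦x⟧ X≡0) , IsZero-complete ρ z (trans ⟦z⟧ (cong (_* Y) X≡0))
    where X≡0 = n<1⇒n≡0 X<1
  LongMul-complete low-complete (suc j) ρ h x y z {X} {Y} ⟦h⟧ ⟦x⟧ ⟦y⟧ ⟦z⟧ X<bʲ⁺¹ QY =
    elem x′ , elem d , elem hx′ , elem x′y , elem hx′y , elem dy ,
    times-complete _ (6 ↑ʳ h) (# 5) (# 3) ⟦h⟧ (value x′) (value hx′) ,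
    resp₃ Sum (value hx′) (value d) ⟦x⟧ X≡ ,
    LongMul-complete low-complete j _ (6 ↑ʳ h) (# 5) (6 ↑ʳ y) (# 2)
      ⟦h⟧ (value x′) ⟦y⟧ (value x′y) X′<bʲ QY ,
    times-complete _ (6 ↑ʳ h) (# 2) (# 1) ⟦h⟧ (value x′y) (value hx′y) ,
    low-complete _ (6 ↑ʳ h) (# 4) (6 ↑ʳ y) (# 0)
      ⟦h⟧ (value d) ⟦y⟧ (value dy) (m%n<n X base) QY ,
    resp₃ Sum (value hx′y) (value dy) ⟦z⟧ (long-multiplication-step base X′ D X Y X≡)
    where
    X′ = X / base
    D = X % base
    X≡ : base * X′ + D ≡ X
    X≡ = n*[m/n]+m%n≡m X base
    X′<bʲ : X′ < base ^ j
    X′<bʲ = m<n*o⇒m/o<n (subst (X <_) (*-comm base (base ^ j)) X<bʲ⁺¹)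
    bX′≤X : base * X′ ≤ X
    bX′≤X = ≤-trans (m≤m+n (base * X′) D) (≤-reflexive X≡)
    x′ = element-below (ρ x) ⟦x⟧ (m/n≤m X base)
    d = element-below (ρ x) ⟦x⟧ (m%n≤m X base)
    hx′ = element-below (ρ x) ⟦x⟧ bX′≤X
    x′y = element-below (ρ z) ⟦z⟧ (*-monoˡ-≤ Y (m/n≤m X base))
    hx′y = element-below (ρ z) ⟦z⟧
             (≤-trans (≤-reflexive (sym (*-assoc base X′ Y))) (*-monoˡ-≤ Y bX′≤X))
    dy = element-below (ρ z) ⟦z⟧ (*-monoˡ-≤ Y (m%n≤m X base))

  Product-complete : Complete (_< base ^ k) (_< base ^ k) (Product k)
  Product-complete = LongMul-complete transposed k
    where
    digit-complete : Complete (_< base) (_< base) DigitProduct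
    digit-complete ρ h d e w ⟦h⟧ ⟦d⟧ ⟦e⟧ ⟦w⟧ D<b E<b =
      resp₃ Atom ⟦d⟧ ⟦e⟧ ⟦w⟧ (digit-product _ _ D<b E<b)
    transposed : Complete (_< base) (_< base ^ k) (λ h d y w → LongMul k DigitProduct k h y d w)
    transposed ρ h d y w {D} {Y} ⟦h⟧ ⟦d⟧ ⟦y⟧ ⟦w⟧ D<b Y<bᵏ =
      LongMul-complete digit-complete k ρ h y d w ⟦h⟧ ⟦y⟧ ⟦d⟧ (trans ⟦w⟧ (*-comm D Y)) Y<bᵏ D<b

  MulFormula-complete : ∀ {a b c} → toℕ a * toℕ b ≡ toℕ c → Sat 𝔑 (MulFormula k) (triple a b c)
  MulFormula-complete {a} {b} e =
    fromℕ< base<n ,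
    Product-complete _ (# 0) (# 1) (# 2) (# 3) (toℕ-fromℕ< base<n) refl refl (sym e) (<bᵏ a) (<bᵏ b)
    where
    <bᵏ : (i : Fin n) → toℕ i < base ^ k
    <bᵏ i = <-≤-trans (toℕ<n i) n≤base^k

Table : ∀ {n} → PartialModel n → ℕ → ℕ → Set
Table 𝔑 p q = ∀ x y → x ≤ p → y ≤ q → T (PartialModel.M 𝔑 x y (x * y))

Good⇒Table : ∀ {n} (𝔑 : PartialModel n) {p q} .{{_ : NonZero q}} →
  Good (PartialModel.M 𝔑) p q → Table 𝔑 p q
Good⇒Table 𝔑 {q = q} (inj₁ q≡0) = ⊥-elim (≢-nonZero⁻¹ q q≡0)
Good⇒Table 𝔑 (inj₂ table) = table

Table⇒MultiplicationBase : ∀ {n} (𝔑 : PartialModel n) k {a g} → Table 𝔑 a g →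
  a < n → n ≤ a ^ k → n ≤ g ^ k → n ≤ k * a * g → MultiplicationBase 𝔑 k
Table⇒MultiplicationBase {n} 𝔑 k {a} {g} table a<n n≤aᵏ n≤gᵏ n≤kag with a ≤? g
... | yes a≤g = record
  { base = a ; range = g ; base<n = a<n ; n≤base^k = n≤aᵏ
  ; n≤base*k*range = subst (n ≤_) (trans (cong (_* g) (*-comm k a)) (*-assoc a k g)) n≤kag
  ; times-base = λ w w≤g → inj₁ (table a w ≤-refl w≤g)
  ; digit-product = λ d e d<a e<a → table d e (<⇒≤ d<a) (≤-trans (<⇒≤ e<a) a≤g)
  }
... | no a≰g = record
  { base = g ; range = a ; base<n = <-trans g<a a<n ; n≤base^k = n≤gᵏ
  ; n≤base*k*range = subst (n ≤_) (*-comm (k * a) g) n≤kag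
  ; times-base = λ w w≤a → inj₂ (table w g w≤a ≤-refl)
  ; digit-product = λ d e d<g e<g → table d e (≤-trans (<⇒≤ d<g) (<⇒≤ g<a)) (<⇒≤ e<g)
  }
  where g<a = ≰⇒> a≰g

Good⇒MultiplicationBase : ∀ {n} (𝔑 : PartialModel n) k′ {a g} → a < n → n ≤ a ^ suc k′ →
  (suc k′ * a) ^ suc k′ ≤ n ^ k′ → Good (PartialModel.M 𝔑) a g → n ≤ suc k′ * a * g →
  MultiplicationBase 𝔑 (suc k′)
Good⇒MultiplicationBase 𝔑 k′ {a} {g} a<n n≤aᵏ [ka]ᵏ≤nᵏ⁻¹ good n≤kag =
  Table⇒MultiplicationBase 𝔑 (suc k′) (Good⇒Table 𝔑 good) a<n n≤aᵏ
    (root-bound {c = suc k′ * a} k′ 0<n n≤kag [ka]ᵏ≤nᵏ⁻¹) n≤kag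
  where
  0<n = ≤-<-trans z≤n a<n
  instance
    g≢0 : NonZero g
    g≢0 = m*n≢0⇒n≢0 (suc k′ * a) {{>-nonZero (<-≤-trans 0<n n≤kag)}}

proposition3p2 : (k : ℕ) → 2 ≤ k →
    Σ (Formula 3) (λ π →
      (n : ℕ) (𝔑 : PartialModel n) → k ^ 2 ≤ n →
      (a* : ℕ) → a* < n →
      n ≤ a* ^ k →
      (k * a*) ^ k ≤ n ^ (k ∸ 1) →
      Σ ℕ (λ g → IsGamma (PartialModel.M 𝔑) a* g × n ≤ k * a* * g) →
      (a b c : Fin n) → Sat 𝔑 π (triple a b c) ⇔ (toℕ a * toℕ b ≡ toℕ c))
proposition3p2 zero ()
proposition3p2 k@(suc k′) _ = MulFormula k ,
  λ n 𝔑 _ a* a*<n n≤a*ᵏ [ka*]ᵏ≤nᵏ⁻¹ (g , (good , _) , n≤ka*g) a b c →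
    mk⇔ (Soundness.MulFormula-sound 𝔑 k)
        (Completeness.MulFormula-complete (Good⇒MultiplicationBase 𝔑 k′ a*<n n≤a*ᵏ [ka*]ᵏ≤nᵏ⁻¹ good n≤ka*g))
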